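{- Let $m\geq 1$ and let $X_1,\dots,X_m$ be elements of a commutative ring (e.g. indeterminates). Let $\mathbf{A}$ be the $2m\times 2m$ matrix $\mathbf{A}=\begin{bmatrix}\mathbf{A}_1\\ \mathbf{A}_2\end{bmatrix}$, where $\mathbf{A}_1=[X_i^{j-1}]_{1\leq i\leq m,\,1\leq j\leq 2m}$ and $\mathbf{A}_2=[jX_i^{j-1}]_{1\leq i\leq m,\,1\leq j\leq 2m}$ (here $i$ indexes rows and $j$ indexes columns). That is, for $1\le i\le m$, row $i$ of $\mathbf{A}$ is $(1, X_i, X_i^2,\dots,X_i^{2m-1})$ and row $m+i$ is $(1, 2X_i, 3X_i^2,\dots,2mX_i^{2m-1})$. Then $$\det\mathbf{A}=(-1)^{\frac{m(m-1)}{2}}\prod_{i=1}^m X_i\prod_{1\leq i<j\leq m}(X_j-X_i)^4.$$ -}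

module Defs where

open import Level using (Level)
open import Algebra.Bundles using (CommutativeRing; Semiring)
open import Data.Nat using (ℕ; zero; suc)
import Data.Nat as ℕ
open import Data.Nat.DivMod using (_/_)
open import Data.Fin using (Fin; toℕ; splitAt; punchIn; _<?_)
open import Data.Sum using (inj₁; inj₂)
open import Relation.Nullary using (yes; no)

module _ {c ℓ : Level} (R : CommutativeRing c ℓ) where
  open CommutativeRing R
  open import Algebra.Definitions.RawSemiring (Semiring.rawSemiring semiring) public
    using (_^_; _×_; sum; product)

  negOnePow : ℕ → Carrier
  negOnePow k = (- 1#) ^ k

  det : (n : ℕ) → (Fin n → Fin n → Carrier) → Carrier
  det zero    M = 1#
  det (suc n) M =
    sum (λ (j : Fin (suc n)) →
      negOnePow (toℕ j) * (M Fin.zero j * det n (λ r s → M (Fin.suc r) (punchIn j s))))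
    where import Data.Fin as Fin

  -- The 2m×2m matrix A of the statement (0-indexed rows r and columns c):
  --   rows i < m   : entry X_i^c           (= X_i^{j-1} with j = c+1)
  --   rows m + i   : entry (c+1)·X_i^c     (= j X_i^{j-1})
  confluentMatrix : (m : ℕ) → (Fin m → Carrier) → Fin (m ℕ.+ m) → Fin (m ℕ.+ m) → Carrier
  confluentMatrix m X r c with splitAt m r
  ... | inj₁ i = X i ^ toℕ c
  ... | inj₂ i = suc (toℕ c) × (X i ^ toℕ c)

  vanderProd4 : (m : ℕ) → (Fin m → Carrier) → Carrier
  vanderProd4 m X = product (λ j → product (λ i → factor i j))
    where
    factor : Fin m → Fin m → Carrier
    factor i j with i <? j
    ... | yes _ = (X j - X i) ^ 4
    ... | no  _ = 1#

  rhs : (m : ℕ) → (Fin m → Carrier) → Carrier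
  rhs m X = negOnePow ((m ℕ.* (m ℕ.∸ 1)) / 2) * (product X * vanderProd4 m X)

-- Subtracting X₁ times each column from the next one does not change the determinant.  It turns
-- the Vandermonde row of X₁ into (1, 0, …, 0), every other Vandermonde row (Xᵣᶜ)_c into
-- ((Xᵣ − X₁)·Xᵣᶜ)_c, and a row (A·(x^(c+1))′ + B·xᶜ)_c into a row of the same kind with
-- coefficients (A(x − X₁), xA + B(x − X₁)).  Expanding along the first row and repeating this for
-- all m nodes splits off the Vandermonde determinant V = ∏_{i<j} (Xⱼ − Xᵢ); afterwards the
-- derivative row of Xᵣ has A = 0 and B = Xᵣ f′(Xᵣ) for f(t) = ∏ₗ (t − Xₗ), so it is Xᵣ f′(Xᵣ) times
-- a Vandermonde row.  As ∏ᵣ f′(Xᵣ) = (−1)^(m(m−1)/2) V², the determinant is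
-- (−1)^(m(m−1)/2) ∏ᵣ Xᵣ · V⁴.

module Submission where

open import Defs using (det; negOnePow; confluentMatrix; vanderProd4; rhs)
open import Level using (Level)
open import Algebra.Bundles using (CommutativeRing; Semiring)
open import Data.Nat using (ℕ; zero; suc; z≤n; s≤s)
import Data.Nat as ℕ
import Data.Nat.Properties as ℕ
import Data.Nat.DivMod as ℕ
import Data.Nat.Tactic.RingSolver as ℕ-Solver
open import Data.Fin using (Fin; toℕ; punchIn; splitAt)
import Data.Fin as Fin
import Data.Fin.Properties as Fin
open import Data.Product using (_,_; proj₁; proj₂) renaming (_×_ to _∧_)
open import Data.Sum using (inj₁; inj₂; _⊎_)
open import Data.Empty using (⊥-elim)
open import Function using (_∘_)
open import Relation.Binary.PropositionalEquality as ≡ using (_≡_; _≢_)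
open import Relation.Nullary using (Dec; yes; no; ¬_)

punchInℕ : ℕ → ℕ → ℕ
punchInℕ zero    s       = suc s
punchInℕ (suc j) zero    = zero
punchInℕ (suc j) (suc s) = suc (punchInℕ j s)

punchOutℕ : ℕ → ℕ → ℕ
punchOutℕ zero    k       = ℕ.pred k
punchOutℕ (suc j) zero    = zero
punchOutℕ (suc j) (suc k) = suc (punchOutℕ j k)

toℕ-punchIn : ∀ {n} (j : Fin (suc n)) (s : Fin n) → toℕ (punchIn j s) ≡ punchInℕ (toℕ j) (toℕ s)
toℕ-punchIn Fin.zero    s          = ≡.refl
toℕ-punchIn (Fin.suc j) Fin.zero    = ≡.refl
toℕ-punchIn (Fin.suc j) (Fin.suc s) = ≡.cong suc (toℕ-punchIn j s)

toℕ-splitAt-inj₁ : ∀ m {n} {r : Fin (m ℕ.+ n)} {i} → splitAt m r ≡ inj₁ i → toℕ r ≡ toℕ i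
toℕ-splitAt-inj₁ m {n} {i = i} split =
  ≡.trans (≡.cong toℕ (≡.sym (Fin.splitAt⁻¹-↑ˡ split))) (Fin.toℕ-↑ˡ i n)

toℕ-splitAt-inj₂ : ∀ m {n} {r : Fin (m ℕ.+ n)} {i} → splitAt m r ≡ inj₂ i → toℕ r ≡ m ℕ.+ toℕ i
toℕ-splitAt-inj₂ m {i = i} split =
  ≡.trans (≡.cong toℕ (≡.sym (Fin.splitAt⁻¹-↑ʳ split))) (Fin.toℕ-↑ʳ m i)

punchInℕ-< : ∀ n j s → j ℕ.< suc n → s ℕ.< n → punchInℕ j s ℕ.< suc n
punchInℕ-< n       zero    s       _         s<n       = s≤s s<n
punchInℕ-< n       (suc j) zero    _         _         = s≤s z≤n
punchInℕ-< (suc n) (suc j) (suc s) (s≤s j<n) (s≤s s<n) = s≤s (punchInℕ-< n j s j<n s<n)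

punchInℕᵢ≢i : ∀ j s → punchInℕ j s ≢ j
punchInℕᵢ≢i (suc j) (suc s) eq = punchInℕᵢ≢i j s (ℕ.suc-injective eq)

punchInℕ-injective : ∀ j s t → punchInℕ j s ≡ punchInℕ j t → s ≡ t
punchInℕ-injective zero    s       t       eq = ℕ.suc-injective eq
punchInℕ-injective (suc j) zero    zero    eq = ≡.refl
punchInℕ-injective (suc j) (suc s) (suc t) eq =
  ≡.cong suc (punchInℕ-injective j s t (ℕ.suc-injective eq))

punchInℕ-punchOutℕ : ∀ j k → j ≢ k → punchInℕ j (punchOutℕ j k) ≡ k
punchInℕ-punchOutℕ zero    zero    j≢k = ⊥-elim (j≢k ≡.refl)
punchInℕ-punchOutℕ zero    (suc k) j≢k = ≡.refl
punchInℕ-punchOutℕ (suc j) zero    j≢k = ≡.refl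
punchInℕ-punchOutℕ (suc j) (suc k) j≢k = ≡.cong suc (punchInℕ-punchOutℕ j k (j≢k ∘ ≡.cong suc))

punchOutℕ-< : ∀ n j k → j ℕ.< suc n → k ℕ.< suc n → j ≢ k → punchOutℕ j k ℕ.< n
punchOutℕ-< n       zero    zero    _         _         j≢k = ⊥-elim (j≢k ≡.refl)
punchOutℕ-< n       zero    (suc k) _         (s≤s k<n) j≢k = k<n
punchOutℕ-< zero    (suc j) zero    (s≤s ())  _         j≢k
punchOutℕ-< (suc n) (suc j) zero    _         _         j≢k = s≤s z≤n
punchOutℕ-< (suc n) (suc j) (suc k) (s≤s j<n) (s≤s k<n) j≢k =
  s≤s (punchOutℕ-< n j k j<n k<n (j≢k ∘ ≡.cong suc))

punchOutℕ-suc : ∀ j k → j ≢ k → j ≢ suc k → punchOutℕ j (suc k) ≡ suc (punchOutℕ j k)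
punchOutℕ-suc zero          zero    j≢k j≢1+k = ⊥-elim (j≢k ≡.refl)
punchOutℕ-suc zero          (suc k) j≢k j≢1+k = ≡.refl
punchOutℕ-suc (suc zero)    zero    j≢k j≢1+k = ⊥-elim (j≢1+k ≡.refl)
punchOutℕ-suc (suc (suc j)) zero    j≢k j≢1+k = ≡.refl
punchOutℕ-suc (suc j)       (suc k) j≢k j≢1+k =
  ≡.cong suc (punchOutℕ-suc j k (j≢k ∘ ≡.cong suc) (j≢1+k ∘ ≡.cong suc))

punchInℕ-≢ : ∀ j s k → j ≢ k → s ≢ punchOutℕ j k → punchInℕ j s ≢ k
punchInℕ-≢ j s k j≢k s≢k′ eq =
  s≢k′ (punchInℕ-injective j s _ (≡.trans eq (≡.sym (punchInℕ-punchOutℕ j k j≢k))))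

punchInℕ-adjacent : ∀ k s →
  punchInℕ k s ≡ punchInℕ (suc k) s ⊎ (punchInℕ k s ≡ suc k ∧ punchInℕ (suc k) s ≡ k)
punchInℕ-adjacent zero    zero    = inj₂ (≡.refl , ≡.refl)
punchInℕ-adjacent zero    (suc s) = inj₁ ≡.refl
punchInℕ-adjacent (suc k) zero    = inj₁ ≡.refl
punchInℕ-adjacent (suc k) (suc s) with punchInℕ-adjacent k s
... | inj₁ eq          = inj₁ (≡.cong suc eq)
... | inj₂ (eq₁ , eq₂) = inj₂ (≡.cong suc eq₁ , ≡.cong suc eq₂)

module ConfluentVandermonde {c ℓ : Level} (R : CommutativeRing c ℓ) where
  open CommutativeRing R hiding (zero)
  open import Algebra.Definitions.RawSemiring (Semiring.rawSemiring semiring)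
    using (_^_; _×_; sum; product)
  open import Algebra.Properties.Ring ring using (-1*x≈-x; ⁻¹-anti-homo‿-)
  open import Algebra.Properties.Semiring.Exp semiring using (^-homo-*)
  open import Algebra.Properties.CommutativeSemigroup +-commutativeSemigroup
    using () renaming (interchange to +-interchange)
  open import Algebra.Properties.CommutativeSemigroup *-commutativeSemigroup
    using () renaming (interchange to *-interchange)
  open import Algebra.Properties.Semiring.Mult semiring using (×-comm-*)
  open import Algebra.Solver.Ring.NaturalCoefficients.Default commutativeSemiring
    using (solve; _:=_; _:+_; _:*_; con)
  open import Relation.Binary.Reasoning.Setoid setoid

  ∑ : ℕ → (ℕ → Carrier) → Carrier
  ∑ zero    f = 0#
  ∑ (suc n) f = f 0 + ∑ n (f ∘ suc)

  ∏ : ℕ → (ℕ → Carrier) → Carrier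
  ∏ zero    f = 1#
  ∏ (suc n) f = f 0 * ∏ n (f ∘ suc)

  ∑-cong : ∀ n {f g} → (∀ j → j ℕ.< n → f j ≈ g j) → ∑ n f ≈ ∑ n g
  ∑-cong zero    f≈g = refl
  ∑-cong (suc n) f≈g = +-cong (f≈g 0 (s≤s z≤n)) (∑-cong n (λ j j<n → f≈g (suc j) (s≤s j<n)))

  ∏-cong : ∀ n {f g} → (∀ j → j ℕ.< n → f j ≈ g j) → ∏ n f ≈ ∏ n g
  ∏-cong zero    f≈g = refl
  ∏-cong (suc n) f≈g = *-cong (f≈g 0 (s≤s z≤n)) (∏-cong n (λ j j<n → f≈g (suc j) (s≤s j<n)))

  ∑-zero : ∀ n {f} → (∀ j → j ℕ.< n → f j ≈ 0#) → ∑ n f ≈ 0#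
  ∑-zero zero    f≈0 = refl
  ∑-zero (suc n) f≈0 =
    trans (+-cong (f≈0 0 (s≤s z≤n)) (∑-zero n (λ j j<n → f≈0 (suc j) (s≤s j<n)))) (+-identityʳ 0#)

  ∏-one : ∀ n {f} → (∀ j → j ℕ.< n → f j ≈ 1#) → ∏ n f ≈ 1#
  ∏-one zero    f≈1 = refl
  ∏-one (suc n) f≈1 =
    trans (*-cong (f≈1 0 (s≤s z≤n)) (∏-one n (λ j j<n → f≈1 (suc j) (s≤s j<n)))) (*-identityʳ 1#)

  ∑-distrib-+ : ∀ n f g → ∑ n (λ j → f j + g j) ≈ ∑ n f + ∑ n g
  ∑-distrib-+ zero    f g = sym (+-identityʳ 0#)
  ∑-distrib-+ (suc n) f g =
    trans (+-cong refl (∑-distrib-+ n (f ∘ suc) (g ∘ suc))) (+-interchange (f 0) (g 0) _ _)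

  ∑-*ˡ : ∀ n k f → ∑ n (λ j → k * f j) ≈ k * ∑ n f
  ∑-*ˡ zero    k f = sym (zeroʳ k)
  ∑-*ˡ (suc n) k f = trans (+-cong refl (∑-*ˡ n k (f ∘ suc))) (sym (distribˡ k _ _))

  ∑-linear : ∀ n b f g → ∑ n (λ j → f j + b * g j) ≈ ∑ n f + b * ∑ n g
  ∑-linear n b f g = trans (∑-distrib-+ n f (λ j → b * g j)) (+-cong refl (∑-*ˡ n b g))

  ∏-distrib-* : ∀ n f g → ∏ n (λ j → f j * g j) ≈ ∏ n f * ∏ n g
  ∏-distrib-* zero    f g = sym (*-identityˡ 1#)
  ∏-distrib-* (suc n) f g =
    trans (*-cong refl (∏-distrib-* n (f ∘ suc) (g ∘ suc))) (*-interchange (f 0) (g 0) _ _)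

  ∏-const : ∀ n k → ∏ n (λ _ → k) ≈ k ^ n
  ∏-const zero    k = refl
  ∏-const (suc n) k = *-cong refl (∏-const n k)

  ∏-^ : ∀ e n f → ∏ n (λ j → f j ^ e) ≈ ∏ n f ^ e
  ∏-^ zero    n f = ∏-one n (λ _ _ → refl)
  ∏-^ (suc e) n f = trans (∏-distrib-* n f (λ j → f j ^ e)) (*-cong refl (∏-^ e n f))

  ∏-split : ∀ m n f → ∏ (m ℕ.+ n) f ≈ ∏ m f * ∏ n (λ l → f (m ℕ.+ l))
  ∏-split zero    n f = sym (*-identityˡ _)
  ∏-split (suc m) n f = trans (*-cong refl (∏-split m n (f ∘ suc))) (sym (*-assoc _ _ _))

  sum≈∑ : ∀ n (f : Fin n → Carrier) g → (∀ j → f j ≈ g (toℕ j)) → sum f ≈ ∑ n g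
  sum≈∑ zero    f g f≈g = refl
  sum≈∑ (suc n) f g f≈g =
    +-cong (f≈g Fin.zero) (sum≈∑ n (f ∘ Fin.suc) (g ∘ suc) (f≈g ∘ Fin.suc))

  product≈∏ : ∀ n (f : Fin n → Carrier) g → (∀ j → f j ≈ g (toℕ j)) → product f ≈ ∏ n g
  product≈∏ zero    f g f≈g = refl
  product≈∏ (suc n) f g f≈g =
    *-cong (f≈g Fin.zero) (product≈∏ n (f ∘ Fin.suc) (g ∘ suc) (f≈g ∘ Fin.suc))

  -- ℕ-indexed, so that shifting rows and columns needs no Fin arithmetic; detℕ n only reads
  -- the leading n × n block.
  Matrix : Set c
  Matrix = ℕ → ℕ → Carrier

  minor : Matrix → ℕ → Matrix
  minor M j r s = M (suc r) (punchInℕ j s)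

  mutual
    detℕ : ℕ → Matrix → Carrier
    detℕ zero    M = 1#
    detℕ (suc n) M = ∑ (suc n) (laplaceTerm n M)

    laplaceTerm : ℕ → Matrix → ℕ → Carrier
    laplaceTerm n M j = negOnePow R j * (M 0 j * detℕ n (minor M j))

  det≈detℕ : ∀ n (M : Fin n → Fin n → Carrier) (N : Matrix) →
    (∀ r c → M r c ≈ N (toℕ r) (toℕ c)) → det R n M ≈ detℕ n N
  det≈detℕ zero    M N M≈N = refl
  det≈detℕ (suc n) M N M≈N = sum≈∑ (suc n) _ (laplaceTerm n N) λ j →
    *-cong refl (*-cong (M≈N Fin.zero j) (det≈detℕ n _ (minor N (toℕ j)) λ r s →
      ≡.subst (λ c → M (Fin.suc r) (punchIn j s) ≈ N (suc (toℕ r)) c)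
              (toℕ-punchIn j s) (M≈N (Fin.suc r) (punchIn j s))))

  detℕ-cong : ∀ n {M N} → (∀ r c → r ℕ.< n → c ℕ.< n → M r c ≈ N r c) → detℕ n M ≈ detℕ n N
  detℕ-cong zero    M≈N = refl
  detℕ-cong (suc n) {M} {N} M≈N = ∑-cong (suc n) {laplaceTerm n M} {laplaceTerm n N} λ j j<n →
    *-cong refl (*-cong (M≈N 0 j (s≤s z≤n) j<n) (detℕ-cong n λ r s r<n s<n →
      M≈N (suc r) _ (s≤s r<n) (punchInℕ-< n j s j<n s<n)))

  detℕ-linear-column : ∀ n k b {M M′ M″} → k ℕ.< n →
    (∀ r → M″ r k ≈ M r k + b * M′ r k) →
    (∀ r c → c ≢ k → M″ r c ≈ M r c) →
    (∀ r c → c ≢ k → M′ r c ≈ M r c) →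
    detℕ n M″ ≈ detℕ n M + b * detℕ n M′
  detℕ-linear-column (suc n) k b {M} {M′} {M″} k<n onColumn off off′ =
    trans (∑-cong (suc n) term) (∑-linear (suc n) b (laplaceTerm n M) (laplaceTerm n M′))
    where
    term : ∀ j → j ℕ.< suc n → laplaceTerm n M″ j ≈ laplaceTerm n M j + b * laplaceTerm n M′ j
    term j j<n with j ℕ.≟ k
    ... | yes ≡.refl = begin
        σ * (M″ 0 j * detℕ n (minor M″ j))
      ≈⟨ *-cong refl (*-cong (onColumn 0) (sameMinor off)) ⟩
        σ * ((M 0 j + b * M′ 0 j) * d)
      ≈⟨ solve 5 (λ σ a b a′ d → σ :* ((a :+ b :* a′) :* d) := σ :* (a :* d) :+ b :* (σ :* (a′ :* d)))
               refl σ (M 0 j) b (M′ 0 j) d ⟩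
        σ * (M 0 j * d) + b * (σ * (M′ 0 j * d))
      ≈⟨ +-cong refl (*-cong refl (*-cong refl (*-cong refl (sym (sameMinor off′))))) ⟩
        σ * (M 0 j * d) + b * (σ * (M′ 0 j * detℕ n (minor M′ j)))
      ∎
      where
      σ = negOnePow R j
      d = detℕ n (minor M j)
      sameMinor : ∀ {N} → (∀ r c → c ≢ j → N r c ≈ M r c) → detℕ n (minor N j) ≈ d
      sameMinor N≈M = detℕ-cong n λ r s _ _ → N≈M (suc r) (punchInℕ j s) (punchInℕᵢ≢i j s)
    ... | no j≢k = begin
        σ * (M″ 0 j * detℕ n (minor M″ j))
      ≈⟨ *-cong refl (*-cong (off 0 j j≢k) minorLinear) ⟩
        σ * (M 0 j * (detℕ n (minor M j) + b * detℕ n (minor M′ j)))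
      ≈⟨ solve 5 (λ σ a b d d′ → σ :* (a :* (d :+ b :* d′)) := σ :* (a :* d) :+ b :* (σ :* (a :* d′)))
               refl σ (M 0 j) b (detℕ n (minor M j)) (detℕ n (minor M′ j)) ⟩
        σ * (M 0 j * detℕ n (minor M j)) + b * (σ * (M 0 j * detℕ n (minor M′ j)))
      ≈⟨ +-cong refl (*-cong refl (*-cong refl (*-cong (sym (off′ 0 j j≢k)) refl))) ⟩
        σ * (M 0 j * detℕ n (minor M j)) + b * (σ * (M′ 0 j * detℕ n (minor M′ j)))
      ∎
      where
      σ = negOnePow R j
      minorLinear : detℕ n (minor M″ j) ≈ detℕ n (minor M j) + b * detℕ n (minor M′ j)
      minorLinear = detℕ-linear-column n (punchOutℕ j k) b (punchOutℕ-< n j k j<n k<n j≢k)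
        (λ r → ≡.subst (λ c → M″ (suc r) c ≈ M (suc r) c + b * M′ (suc r) c)
                       (≡.sym (punchInℕ-punchOutℕ j k j≢k)) (onColumn (suc r)))
        (λ r s s≢k′ → off (suc r) _ (punchInℕ-≢ j s k j≢k s≢k′))
        (λ r s s≢k′ → off′ (suc r) _ (punchInℕ-≢ j s k j≢k s≢k′))

  ∑-cancelling-pair : ∀ n k f → suc k ℕ.< n →
    (∀ j → j ℕ.< n → j ≢ k → j ≢ suc k → f j ≈ 0#) → f k + f (suc k) ≈ 0# → ∑ n f ≈ 0#
  ∑-cancelling-pair (suc (suc n)) zero f _ others pair = begin
      f 0 + (f 1 + ∑ n (f ∘ suc ∘ suc))
    ≈⟨ +-cong refl (+-cong refl (∑-zero n λ j j<n → others (suc (suc j)) (s≤s (s≤s j<n)) (λ ()) (λ ()))) ⟩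
      f 0 + (f 1 + 0#)
    ≈⟨ +-cong refl (+-identityʳ _) ⟩
      f 0 + f 1
    ≈⟨ pair ⟩
      0#
    ∎
  ∑-cancelling-pair (suc n) (suc k) f (s≤s 1+k<n) others pair = begin
      f 0 + ∑ n (f ∘ suc)
    ≈⟨ +-cong (others 0 (s≤s z≤n) (λ ()) (λ ()))
              (∑-cancelling-pair n k (f ∘ suc) 1+k<n
                 (λ j j<n j≢k j≢1+k → others (suc j) (s≤s j<n)
                                        (j≢k ∘ ℕ.suc-injective) (j≢1+k ∘ ℕ.suc-injective))
                 pair) ⟩
      0# + 0#
    ≈⟨ +-identityʳ 0# ⟩
      0#
    ∎

  detℕ-equal-adjacent-columns : ∀ n k M → suc k ℕ.< n → (∀ r → M r k ≈ M r (suc k)) → detℕ n M ≈ 0#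
  detℕ-equal-adjacent-columns (suc n) k M 1+k<n equal =
    ∑-cancelling-pair (suc n) k (laplaceTerm n M) 1+k<n vanishing cancelling
    where
    vanishing : ∀ j → j ℕ.< suc n → j ≢ k → j ≢ suc k → laplaceTerm n M j ≈ 0#
    vanishing j j<n j≢k j≢1+k =
      trans (*-cong refl (*-cong refl minor≈0)) (trans (*-cong refl (zeroʳ _)) (zeroʳ _))
      where
      k′ = punchOutℕ j k
      1+k′≡ : punchOutℕ j (suc k) ≡ suc k′
      1+k′≡ = punchOutℕ-suc j k j≢k j≢1+k
      minor≈0 : detℕ n (minor M j) ≈ 0#
      minor≈0 = detℕ-equal-adjacent-columns n k′ (minor M j)
        (≡.subst (ℕ._< n) 1+k′≡ (punchOutℕ-< n j (suc k) j<n 1+k<n j≢1+k))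
        (λ r → ≡.subst₂ (λ c c′ → M (suc r) c ≈ M (suc r) c′)
                 (≡.sym (punchInℕ-punchOutℕ j k j≢k))
                 (≡.sym (≡.trans (≡.cong (punchInℕ j) (≡.sym 1+k′≡)) (punchInℕ-punchOutℕ j (suc k) j≢1+k)))
                 (equal (suc r)))
    sameMinor : detℕ n (minor M k) ≈ detℕ n (minor M (suc k))
    sameMinor = detℕ-cong n λ r s _ _ → sameEntry r s (punchInℕ-adjacent k s)
      where
      sameEntry : ∀ r s →
        punchInℕ k s ≡ punchInℕ (suc k) s ⊎ (punchInℕ k s ≡ suc k ∧ punchInℕ (suc k) s ≡ k) →
        M (suc r) (punchInℕ k s) ≈ M (suc r) (punchInℕ (suc k) s)
      sameEntry r s (inj₁ eq)          = reflexive (≡.cong (M (suc r)) eq)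
      sameEntry r s (inj₂ (eq₁ , eq₂)) =
        ≡.subst₂ (λ c c′ → M (suc r) c ≈ M (suc r) c′) (≡.sym eq₁) (≡.sym eq₂) (sym (equal (suc r)))
    cancelling : laplaceTerm n M k + laplaceTerm n M (suc k) ≈ 0#
    cancelling = begin
        t + (- 1# * negOnePow R k) * (M 0 (suc k) * detℕ n (minor M (suc k)))
      ≈⟨ +-cong refl (*-cong refl (*-cong (sym (equal 0)) (sym sameMinor))) ⟩
        t + (- 1# * negOnePow R k) * (M 0 k * detℕ n (minor M k))
      ≈⟨ +-cong refl (trans (*-assoc _ _ _) (-1*x≈-x _)) ⟩
        t - t
      ≈⟨ -‿inverseʳ t ⟩
        0#
      ∎
      where t = laplaceTerm n M k

  duplicateColumn : Matrix → ℕ → Matrix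
  duplicateColumn M k r c with c ℕ.≟ suc k
  ... | yes _ = M r k
  ... | no  _ = M r c

  duplicateColumn-≡ : ∀ M k r → duplicateColumn M k r (suc k) ≡ M r k
  duplicateColumn-≡ M k r with suc k ℕ.≟ suc k
  ... | yes _   = ≡.refl
  ... | no  k≢k = ⊥-elim (k≢k ≡.refl)

  duplicateColumn-≢ : ∀ M k r c → c ≢ suc k → duplicateColumn M k r c ≡ M r c
  duplicateColumn-≢ M k r c c≢1+k with c ℕ.≟ suc k
  ... | yes c≡1+k = ⊥-elim (c≢1+k c≡1+k)
  ... | no  _     = ≡.refl

  detℕ-add-previous-column : ∀ n k b {M M′} → suc k ℕ.< n →
    (∀ r → M′ r (suc k) ≈ M r (suc k) + b * M r k) →
    (∀ r c → c ≢ suc k → M′ r c ≈ M r c) →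
    detℕ n M′ ≈ detℕ n M
  detℕ-add-previous-column n k b {M} {M′} 1+k<n onColumn off = begin
      detℕ n M′
    ≈⟨ detℕ-linear-column n (suc k) b 1+k<n
         (λ r → trans (onColumn r) (+-cong refl (*-cong refl (reflexive (≡.sym (duplicateColumn-≡ M k r))))))
         off (λ r c c≢1+k → reflexive (duplicateColumn-≢ M k r c c≢1+k)) ⟩
      detℕ n M + b * detℕ n (duplicateColumn M k)
    ≈⟨ +-cong refl (trans (*-cong refl duplicate≈0) (zeroʳ b)) ⟩
      detℕ n M + 0#
    ≈⟨ +-identityʳ _ ⟩
      detℕ n M
    ∎
    where
    duplicate≈0 : detℕ n (duplicateColumn M k) ≈ 0#
    duplicate≈0 = detℕ-equal-adjacent-columns n k (duplicateColumn M k) 1+k<n λ r →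
      reflexive (≡.trans (duplicateColumn-≢ M k r k (ℕ.1+n≢n ∘ ≡.sym)) (≡.sym (duplicateColumn-≡ M k r)))

  columnDifferences : Carrier → Matrix → Matrix
  columnDifferences a M r zero    = M r zero
  columnDifferences a M r (suc c) = M r (suc c) + (- a) * M r c

  -- Differencing the columns one at a time from the last one down, each step subtracts a multiple
  -- of a column that is still unchanged.
  columnDifferencesFrom : ℕ → Carrier → Matrix → Matrix
  columnDifferencesFrom k a M r c with k ℕ.≤? c
  ... | yes _ = columnDifferences a M r c
  ... | no  _ = M r c

  columnDifferencesFrom-≤ : ∀ k a M r c → k ℕ.≤ c →
    columnDifferencesFrom k a M r c ≡ columnDifferences a M r c
  columnDifferencesFrom-≤ k a M r c k≤c with k ℕ.≤? c
  ... | yes _   = ≡.refl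
  ... | no  k≰c = ⊥-elim (k≰c k≤c)

  columnDifferencesFrom-≰ : ∀ k a M r c → ¬ k ℕ.≤ c → columnDifferencesFrom k a M r c ≡ M r c
  columnDifferencesFrom-≰ k a M r c k≰c with k ℕ.≤? c
  ... | yes k≤c = ⊥-elim (k≰c k≤c)
  ... | no  _   = ≡.refl

  detℕ-columnDifferencesFrom-suc : ∀ n k a M → suc k ℕ.< n →
    detℕ n (columnDifferencesFrom (suc k) a M) ≈ detℕ n (columnDifferencesFrom (suc (suc k)) a M)
  detℕ-columnDifferencesFrom-suc n k a M 1+k<n =
    detℕ-add-previous-column n k (- a) 1+k<n onColumn off
    where
    onColumn : ∀ r → columnDifferencesFrom (suc k) a M r (suc k) ≈
      columnDifferencesFrom (suc (suc k)) a M r (suc k) + (- a) * columnDifferencesFrom (suc (suc k)) a M r k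
    onColumn r = reflexive (≡.trans (columnDifferencesFrom-≤ (suc k) a M r (suc k) ℕ.≤-refl)
      (≡.sym (≡.cong₂ (λ x y → x + (- a) * y)
        (columnDifferencesFrom-≰ (suc (suc k)) a M r (suc k) (ℕ.n≮n (suc k)))
        (columnDifferencesFrom-≰ (suc (suc k)) a M r k (ℕ.<⇒≱ (ℕ.m<n⇒m<1+n (ℕ.n<1+n k)))))))
    off : ∀ r c → c ≢ suc k →
      columnDifferencesFrom (suc k) a M r c ≈ columnDifferencesFrom (suc (suc k)) a M r c
    off r c c≢1+k = byCases (suc k ℕ.≤? c)
      where
      byCases : Dec (suc k ℕ.≤ c) →
        columnDifferencesFrom (suc k) a M r c ≈ columnDifferencesFrom (suc (suc k)) a M r c
      byCases (yes 1+k≤c) = reflexive (≡.trans (columnDifferencesFrom-≤ (suc k) a M r c 1+k≤c)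
        (≡.sym (columnDifferencesFrom-≤ (suc (suc k)) a M r c (ℕ.≤∧≢⇒< 1+k≤c (c≢1+k ∘ ≡.sym)))))
      byCases (no 1+k≰c) = reflexive (≡.trans (columnDifferencesFrom-≰ (suc k) a M r c 1+k≰c)
        (≡.sym (columnDifferencesFrom-≰ (suc (suc k)) a M r c (1+k≰c ∘ ℕ.≤-trans (ℕ.n≤1+n (suc k))))))

  detℕ-columnDifferencesFrom : ∀ n a M d k → 1 ℕ.≤ k → k ℕ.+ d ≡ n →
    detℕ n (columnDifferencesFrom k a M) ≈ detℕ n (columnDifferencesFrom n a M)
  detℕ-columnDifferencesFrom n a M zero k _ k+0≡n =
    reflexive (≡.cong (λ k → detℕ n (columnDifferencesFrom k a M))
                      (≡.trans (≡.sym (ℕ.+-identityʳ k)) k+0≡n))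
  detℕ-columnDifferencesFrom n a M (suc d) (suc k) _ k+d≡n = trans
    (detℕ-columnDifferencesFrom-suc n k a M (≡.subst (suc k ℕ.<_) k+d≡n (ℕ.m<m+n (suc k) (s≤s z≤n))))
    (detℕ-columnDifferencesFrom n a M d (suc (suc k)) (s≤s z≤n)
       (≡.trans (≡.sym (ℕ.+-suc (suc k) d)) k+d≡n))

  detℕ-columnDifferences : ∀ n a M → detℕ n (columnDifferences a M) ≈ detℕ n M
  detℕ-columnDifferences zero    a M = refl
  detℕ-columnDifferences (suc n) a M = begin
      detℕ (suc n) (columnDifferences a M)
    ≈⟨ detℕ-cong (suc n) (λ r c _ _ → fromColumn1 r c) ⟩
      detℕ (suc n) (columnDifferencesFrom 1 a M)
    ≈⟨ detℕ-columnDifferencesFrom (suc n) a M n 1 ℕ.≤-refl ≡.refl ⟩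
      detℕ (suc n) (columnDifferencesFrom (suc n) a M)
    ≈⟨ detℕ-cong (suc n) (λ r c _ c<n → reflexive (columnDifferencesFrom-≰ (suc n) a M r c (ℕ.<⇒≱ c<n))) ⟩
      detℕ (suc n) M
    ∎
    where
    fromColumn1 : ∀ r c → columnDifferences a M r c ≈ columnDifferencesFrom 1 a M r c
    fromColumn1 r zero    = reflexive (≡.sym (columnDifferencesFrom-≰ 1 a M r 0 λ ()))
    fromColumn1 r (suc c) = reflexive (≡.sym (columnDifferencesFrom-≤ 1 a M r (suc c) (s≤s z≤n)))

  detℕ-unit-first-row : ∀ n M → M 0 0 ≈ 1# → (∀ c → M 0 (suc c) ≈ 0#) →
    detℕ (suc n) M ≈ detℕ n (λ r s → M (suc r) (suc s))
  detℕ-unit-first-row n M M00≈1 M0c≈0 = begin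
      1# * (M 0 0 * detℕ n (minor M 0)) + ∑ n (laplaceTerm n M ∘ suc)
    ≈⟨ +-cong (trans (*-identityˡ _) (trans (*-cong M00≈1 refl) (*-identityˡ _)))
              (∑-zero n λ j _ → trans (*-cong refl (trans (*-cong (M0c≈0 j) refl) (zeroˡ _))) (zeroʳ _)) ⟩
      detℕ n (minor M 0) + 0#
    ≈⟨ +-identityʳ _ ⟩
      detℕ n (minor M 0)
    ∎

  detℕ-scale-rows : ∀ n f {M N} → (∀ r c → r ℕ.< n → c ℕ.< n → M r c ≈ f r * N r c) →
    detℕ n M ≈ ∏ n f * detℕ n N
  detℕ-scale-rows zero    f M≈fN = sym (*-identityˡ 1#)
  detℕ-scale-rows (suc n) f {M} {N} M≈fN =
    trans (∑-cong (suc n) term) (∑-*ˡ (suc n) (∏ (suc n) f) (laplaceTerm n N))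
    where
    term : ∀ j → j ℕ.< suc n → laplaceTerm n M j ≈ ∏ (suc n) f * laplaceTerm n N j
    term j j<n = begin
        σ * (M 0 j * detℕ n (minor M j))
      ≈⟨ *-cong refl (*-cong (M≈fN 0 j (s≤s z≤n) j<n) minorScaled) ⟩
        σ * ((f 0 * N 0 j) * (∏ n (f ∘ suc) * detℕ n (minor N j)))
      ≈⟨ solve 5 (λ σ f₀ a p d → σ :* ((f₀ :* a) :* (p :* d)) := (f₀ :* p) :* (σ :* (a :* d)))
               refl σ (f 0) (N 0 j) (∏ n (f ∘ suc)) (detℕ n (minor N j)) ⟩
        ∏ (suc n) f * (σ * (N 0 j * detℕ n (minor N j)))
      ∎
      where
      σ = negOnePow R j
      minorScaled : detℕ n (minor M j) ≈ ∏ n (f ∘ suc) * detℕ n (minor N j)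
      minorScaled = detℕ-scale-rows n (f ∘ suc) λ r s r<n s<n →
        M≈fN (suc r) _ (s≤s r<n) (punchInℕ-< n j s j<n s<n)

  differencesBelow : (ℕ → Carrier) → ℕ → Carrier
  differencesBelow Y r = ∏ r (λ l → Y r - Y l)

  differencesAbove : ℕ → (ℕ → Carrier) → ℕ → Carrier
  differencesAbove m Y r = ∏ (m ℕ.∸ suc r) (λ l → Y r - Y (r ℕ.+ suc l))

  vandermonde : ℕ → (ℕ → Carrier) → Carrier
  vandermonde m Y = ∏ m (differencesBelow Y)

  vandermonde-suc : ∀ p Y → vandermonde (suc p) Y ≈ ∏ p (λ r → Y (suc r) - Y 0) * vandermonde p (Y ∘ suc)
  vandermonde-suc p Y =
    trans (*-identityˡ _) (∏-distrib-* p (λ r → Y (suc r) - Y 0) (differencesBelow (Y ∘ suc)))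

  -- A · (x^(c+1))′ + B · xᶜ
  mixedRow : Carrier → Carrier ∧ Carrier → ℕ → Carrier
  mixedRow x AB c = (suc c × x ^ c) * proj₁ AB + x ^ c * proj₂ AB

  pureDerivative : Carrier ∧ Carrier
  pureDerivative = (1# , 0#)

  absorbNode : Carrier → Carrier → Carrier ∧ Carrier → Carrier ∧ Carrier
  absorbNode a x AB = (proj₁ AB * (x - a) , x * proj₁ AB + proj₂ AB * (x - a))

  absorbNodes : ℕ → (ℕ → Carrier) → Carrier → Carrier ∧ Carrier → Carrier ∧ Carrier
  absorbNodes zero    Y x AB = AB
  absorbNodes (suc p) Y x AB = absorbNodes p (Y ∘ suc) x (absorbNode (Y 0) x AB)

  partialConfluent : ℕ → (ℕ → Carrier) → (ℕ → Carrier) → (ℕ → Carrier ∧ Carrier) → Matrix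
  partialConfluent zero    Y Z AB r       c = mixedRow (Z r) (AB r) c
  partialConfluent (suc p) Y Z AB zero    c = Y 0 ^ c
  partialConfluent (suc p) Y Z AB (suc r) c = partialConfluent p (Y ∘ suc) Z AB r c

  partialConfluent-< : ∀ p Y Z AB r c → r ℕ.< p → partialConfluent p Y Z AB r c ≡ Y r ^ c
  partialConfluent-< (suc p) Y Z AB zero    c _         = ≡.refl
  partialConfluent-< (suc p) Y Z AB (suc r) c (s≤s r<p) = partialConfluent-< p (Y ∘ suc) Z AB r c r<p

  partialConfluent-+ : ∀ p Y Z AB i c → partialConfluent p Y Z AB (p ℕ.+ i) c ≡ mixedRow (Z i) (AB i) c
  partialConfluent-+ zero    Y Z AB i c = ≡.refl
  partialConfluent-+ (suc p) Y Z AB i c = partialConfluent-+ p (Y ∘ suc) Z AB i c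

  powerRow-difference : ∀ y a c → y ^ suc c + (- a) * y ^ c ≈ (y - a) * y ^ c
  powerRow-difference y a c = sym (distribʳ (y ^ c) y (- a))

  mixedRow-difference : ∀ x a AB c →
    mixedRow x AB (suc c) + (- a) * mixedRow x AB c ≈ mixedRow x (absorbNode a x AB) c
  mixedRow-difference x a (A , B) c = begin
      (suc (suc c) × (x * xᶜ)) * A + (x * xᶜ) * B + (- a) * ((suc c × xᶜ) * A + xᶜ * B)
    ≈⟨ +-cong (+-cong (*-cong (+-cong refl (sym (×-comm-* (suc c) x xᶜ))) refl) refl) refl ⟩
      (x * xᶜ + x * (suc c × xᶜ)) * A + (x * xᶜ) * B + (- a) * ((suc c × xᶜ) * A + xᶜ * B)
    ≈⟨ solve 6 (λ x xᶜ n A B b →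
                  (x :* xᶜ :+ x :* n) :* A :+ x :* xᶜ :* B :+ b :* (n :* A :+ xᶜ :* B)
               := n :* (A :* (x :+ b)) :+ xᶜ :* (x :* A :+ B :* (x :+ b)))
             refl x xᶜ (suc c × xᶜ) A B (- a) ⟩
      (suc c × xᶜ) * (A * (x - a)) + xᶜ * (x * A + B * (x - a))
    ∎
    where xᶜ = x ^ c

  rowFactor : ℕ → (ℕ → Carrier) → Carrier → ℕ → Carrier
  rowFactor zero    Y a r       = 1#
  rowFactor (suc p) Y a zero    = Y 0 - a
  rowFactor (suc p) Y a (suc r) = rowFactor p (Y ∘ suc) a r

  ∏-rowFactor : ∀ p q Y a → ∏ (p ℕ.+ q) (rowFactor p Y a) ≈ ∏ p (λ r → Y r - a)
  ∏-rowFactor zero    q Y a = ∏-one q (λ _ _ → refl)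
  ∏-rowFactor (suc p) q Y a = *-cong refl (∏-rowFactor p q (Y ∘ suc) a)

  partialConfluent-difference : ∀ p Y Z AB a r c →
    partialConfluent p Y Z AB r (suc c) + (- a) * partialConfluent p Y Z AB r c ≈
    rowFactor p Y a r * partialConfluent p Y Z (λ i → absorbNode a (Z i) (AB i)) r c
  partialConfluent-difference zero    Y Z AB a r       c =
    trans (mixedRow-difference (Z r) a (AB r) c) (sym (*-identityˡ _))
  partialConfluent-difference (suc p) Y Z AB a zero    c = powerRow-difference (Y 0) a c
  partialConfluent-difference (suc p) Y Z AB a (suc r) c = partialConfluent-difference p (Y ∘ suc) Z AB a r c

  detℕ-partialConfluent : ∀ p q Y Z AB →
    detℕ (p ℕ.+ q) (partialConfluent p Y Z AB) ≈
    vandermonde p Y * detℕ q (λ r → mixedRow (Z r) (absorbNodes p Y (Z r) (AB r)))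
  detℕ-partialConfluent zero    q Y Z AB = sym (*-identityˡ _)
  detℕ-partialConfluent (suc p) q Y Z AB = begin
      detℕ (suc n) M
    ≈⟨ sym (detℕ-columnDifferences (suc n) a M) ⟩
      detℕ (suc n) (columnDifferences a M)
    ≈⟨ detℕ-unit-first-row n (columnDifferences a M) refl firstRow≈0 ⟩
      detℕ n (λ r c → columnDifferences a M (suc r) (suc c))
    ≈⟨ detℕ-scale-rows n (rowFactor p (Y ∘ suc) a)
         (λ r c _ _ → partialConfluent-difference p (Y ∘ suc) Z AB a r c) ⟩
      ∏ n (rowFactor p (Y ∘ suc) a) * detℕ n (partialConfluent p (Y ∘ suc) Z AB′)
    ≈⟨ *-cong (∏-rowFactor p q (Y ∘ suc) a) (detℕ-partialConfluent p q (Y ∘ suc) Z AB′) ⟩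
      ∏ p (λ r → Y (suc r) - a) * (vandermonde p (Y ∘ suc) * D)
    ≈⟨ sym (*-assoc _ _ _) ⟩
      (∏ p (λ r → Y (suc r) - a) * vandermonde p (Y ∘ suc)) * D
    ≈⟨ *-cong (sym (vandermonde-suc p Y)) refl ⟩
      vandermonde (suc p) Y * D
    ∎
    where
    n = p ℕ.+ q
    a = Y 0
    M = partialConfluent (suc p) Y Z AB
    AB′ : ℕ → Carrier ∧ Carrier
    AB′ i = absorbNode a (Z i) (AB i)
    D = detℕ q (λ r → mixedRow (Z r) (absorbNodes (suc p) Y (Z r) (AB r)))
    firstRow≈0 : ∀ c → columnDifferences a M 0 (suc c) ≈ 0#
    firstRow≈0 c = trans (powerRow-difference a a c) (trans (*-cong (-‿inverseʳ a) refl) (zeroˡ _))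

  confluentℕ : ℕ → (ℕ → Carrier) → Matrix
  confluentℕ m Y = partialConfluent m Y Y (λ _ → pureDerivative)

  detℕ-vandermonde : ∀ m Y → detℕ m (λ r c → Y r ^ c) ≈ vandermonde m Y
  detℕ-vandermonde m Y = begin
      detℕ m (λ r c → Y r ^ c)
    ≈⟨ detℕ-cong m (λ r c r<m _ → reflexive (≡.sym (partialConfluent-< m Y Y _ r c r<m))) ⟩
      detℕ m (confluentℕ m Y)
    ≡⟨ ≡.cong (λ n → detℕ n (confluentℕ m Y)) (≡.sym (ℕ.+-identityʳ m)) ⟩
      detℕ (m ℕ.+ 0) (confluentℕ m Y)
    ≈⟨ detℕ-partialConfluent m 0 Y Y _ ⟩
      vandermonde m Y * 1#
    ≈⟨ *-identityʳ _ ⟩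
      vandermonde m Y
    ∎

  -- Y r · f′(Y r) for f(t) = ∏ₗ (t − Y l): the second coefficient left by absorbing all nodes at x = Y r.
  nodeWeight : ℕ → (ℕ → Carrier) → ℕ → Carrier
  nodeWeight m Y r = Y r * (differencesBelow Y r * differencesAbove m Y r)

  absorbNodes-+ : ∀ k p Y x AB →
    absorbNodes (k ℕ.+ p) Y x AB ≡ absorbNodes p (λ l → Y (k ℕ.+ l)) x (absorbNodes k Y x AB)
  absorbNodes-+ zero    p Y x AB = ≡.refl
  absorbNodes-+ (suc k) p Y x AB = absorbNodes-+ k p (Y ∘ suc) x _

  proj₁-absorbNodes : ∀ k Y x AB → proj₁ (absorbNodes k Y x AB) ≈ proj₁ AB * ∏ k (λ l → x - Y l)
  proj₁-absorbNodes zero    Y x AB = sym (*-identityʳ _)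
  proj₁-absorbNodes (suc k) Y x AB = trans (proj₁-absorbNodes k (Y ∘ suc) x _) (*-assoc _ _ _)

  absorbNodes-from-zero : ∀ p Y x AB → proj₁ AB ≈ 0# →
    proj₁ (absorbNodes p Y x AB) ≈ 0# ∧ proj₂ (absorbNodes p Y x AB) ≈ proj₂ AB * ∏ p (λ l → x - Y l)
  absorbNodes-from-zero zero    Y x AB A≈0 = A≈0 , sym (*-identityʳ _)
  absorbNodes-from-zero (suc p) Y x (A , B) A≈0
    with absorbNodes-from-zero p (Y ∘ suc) x (absorbNode (Y 0) x (A , B)) (trans (*-cong A≈0 refl) (zeroˡ _))
  ... | A′≈0 , B′≈ = A′≈0 , trans B′≈ (trans (*-cong xA+B≈B refl) (*-assoc _ _ _))
    where
    xA+B≈B : x * A + B * (x - Y 0) ≈ B * (x - Y 0)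
    xA+B≈B = trans (+-cong (trans (*-cong refl A≈0) (zeroʳ x)) refl) (+-identityˡ _)

  absorbNodes-through-node : ∀ r t Y →
    proj₁ (absorbNodes (r ℕ.+ suc t) Y (Y r) pureDerivative) ≈ 0# ∧
    proj₂ (absorbNodes (r ℕ.+ suc t) Y (Y r) pureDerivative) ≈
      (Y r * differencesBelow Y r) * ∏ t (λ l → Y r - Y (r ℕ.+ suc l))
  absorbNodes-through-node r t Y rewrite absorbNodes-+ r (suc t) Y (Y r) pureDerivative =
    proj₁ afterNode , trans (proj₂ afterNode) (*-cong atNode refl)
    where
    x = Y r
    AB = absorbNodes r Y x pureDerivative
    x-x≈0 : x - Y (r ℕ.+ 0) ≈ 0#
    x-x≈0 = trans (+-cong refl (-‿cong (reflexive (≡.cong Y (ℕ.+-identityʳ r))))) (-‿inverseʳ x)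
    afterNode = absorbNodes-from-zero t (λ l → Y (r ℕ.+ suc l)) x (absorbNode (Y (r ℕ.+ 0)) x AB)
                  (trans (*-cong refl x-x≈0) (zeroʳ _))
    atNode : x * proj₁ AB + proj₂ AB * (x - Y (r ℕ.+ 0)) ≈ x * differencesBelow Y r
    atNode = begin
        x * proj₁ AB + proj₂ AB * (x - Y (r ℕ.+ 0))
      ≈⟨ +-cong refl (trans (*-cong refl x-x≈0) (zeroʳ _)) ⟩
        x * proj₁ AB + 0#
      ≈⟨ +-identityʳ _ ⟩
        x * proj₁ AB
      ≈⟨ *-cong refl (trans (proj₁-absorbNodes r Y x pureDerivative) (*-identityˡ _)) ⟩
        x * differencesBelow Y r
      ∎

  mixedRow-at-node : ∀ m Y r c → r ℕ.< m →
    mixedRow (Y r) (absorbNodes m Y (Y r) pureDerivative) c ≈ nodeWeight m Y r * Y r ^ c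
  mixedRow-at-node m Y r c r<m = begin
      (suc c × Y r ^ c) * proj₁ (absorbNodes m Y (Y r) pureDerivative) +
        Y r ^ c * proj₂ (absorbNodes m Y (Y r) pureDerivative)
    ≈⟨ +-cong (trans (*-cong refl (proj₁ atNode)) (zeroʳ _)) (*-cong refl (proj₂ atNode)) ⟩
      0# + Y r ^ c * ((Y r * differencesBelow Y r) * differencesAbove m Y r)
    ≈⟨ trans (+-identityˡ _) (trans (*-comm _ _) (*-cong (*-assoc _ _ _) refl)) ⟩
      nodeWeight m Y r * Y r ^ c
    ∎
    where
    AtNode : ℕ → Set ℓ
    AtNode n = proj₁ (absorbNodes n Y (Y r) pureDerivative) ≈ 0# ∧
               proj₂ (absorbNodes n Y (Y r) pureDerivative) ≈
                 (Y r * differencesBelow Y r) * differencesAbove m Y r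
    atNode : AtNode m
    atNode = ≡.subst AtNode (≡.trans (ℕ.+-suc r _) (ℕ.m+[n∸m]≡n r<m))
                            (absorbNodes-through-node r (m ℕ.∸ suc r) Y)

  detℕ-confluentℕ : ∀ m Y →
    detℕ (m ℕ.+ m) (confluentℕ m Y) ≈ vandermonde m Y * (∏ m (nodeWeight m Y) * vandermonde m Y)
  detℕ-confluentℕ m Y = begin
      detℕ (m ℕ.+ m) (confluentℕ m Y)
    ≈⟨ detℕ-partialConfluent m m Y Y _ ⟩
      vandermonde m Y * detℕ m (λ r → mixedRow (Y r) (absorbNodes m Y (Y r) pureDerivative))
    ≈⟨ *-cong refl (detℕ-scale-rows m (nodeWeight m Y) (λ r c r<m _ → mixedRow-at-node m Y r c r<m)) ⟩
      vandermonde m Y * (∏ m (nodeWeight m Y) * detℕ m (λ r c → Y r ^ c))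
    ≈⟨ *-cong refl (*-cong refl (detℕ-vandermonde m Y)) ⟩
      vandermonde m Y * (∏ m (nodeWeight m Y) * vandermonde m Y)
    ∎

  triangle : ℕ → ℕ
  triangle zero    = 0
  triangle (suc p) = p ℕ.+ triangle p

  triangle≡ : ∀ m → triangle m ≡ m ℕ.* (m ℕ.∸ 1) ℕ./ 2
  triangle≡ m = ≡.trans (≡.sym (ℕ.m*n/n≡m (triangle m) 2)) (≡.cong (ℕ._/ 2) (triangle*2 m))
    where
    step : ∀ q → suc q ℕ.* 2 ℕ.+ suc q ℕ.* q ≡ suc (suc q) ℕ.* suc q
    step = ℕ-Solver.solve-∀
    triangle*2 : ∀ m → triangle m ℕ.* 2 ≡ m ℕ.* (m ℕ.∸ 1)
    triangle*2 zero          = ≡.refl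
    triangle*2 (suc zero)    = ≡.refl
    triangle*2 (suc (suc q)) =
      ≡.trans (ℕ.*-distribʳ-+ 2 (suc q) (triangle (suc q)))
              (≡.trans (≡.cong (suc q ℕ.* 2 ℕ.+_) (triangle*2 (suc q))) (step q))

  ∏-flip : ∀ p a (g : ℕ → Carrier) → ∏ p (λ l → a - g l) ≈ (- 1#) ^ p * ∏ p (λ l → g l - a)
  ∏-flip p a g = begin
      ∏ p (λ l → a - g l)
    ≈⟨ ∏-cong p (λ l _ → sym (trans (-1*x≈-x _) (⁻¹-anti-homo‿- (g l) a))) ⟩
      ∏ p (λ l → - 1# * (g l - a))
    ≈⟨ ∏-distrib-* p (λ _ → - 1#) (λ l → g l - a) ⟩
      ∏ p (λ _ → - 1#) * ∏ p (λ l → g l - a)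
    ≈⟨ *-cong (∏-const p (- 1#)) refl ⟩
      (- 1#) ^ p * ∏ p (λ l → g l - a)
    ∎

  ∏-differencesAbove : ∀ m Y → ∏ m (differencesAbove m Y) ≈ (- 1#) ^ triangle m * vandermonde m Y
  ∏-differencesAbove zero    Y = sym (*-identityˡ 1#)
  ∏-differencesAbove (suc p) Y = begin
      ∏ p (λ l → Y 0 - Y (suc l)) * ∏ p (differencesAbove p (Y ∘ suc))
    ≈⟨ *-cong (∏-flip p (Y 0) (Y ∘ suc)) (∏-differencesAbove p (Y ∘ suc)) ⟩
      ((- 1#) ^ p * P) * ((- 1#) ^ triangle p * vandermonde p (Y ∘ suc))
    ≈⟨ *-interchange ((- 1#) ^ p) P _ _ ⟩
      ((- 1#) ^ p * (- 1#) ^ triangle p) * (P * vandermonde p (Y ∘ suc))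
    ≈⟨ *-cong (sym (^-homo-* (- 1#) p (triangle p))) (sym (vandermonde-suc p Y)) ⟩
      (- 1#) ^ triangle (suc p) * vandermonde (suc p) Y
    ∎
    where P = ∏ p (λ l → Y (suc l) - Y 0)

  ∏-nodeWeight : ∀ m Y →
    ∏ m (nodeWeight m Y) ≈ ∏ m Y * (vandermonde m Y * ((- 1#) ^ triangle m * vandermonde m Y))
  ∏-nodeWeight m Y =
    trans (∏-distrib-* m Y _)
      (*-cong refl (trans (∏-distrib-* m (differencesBelow Y) (differencesAbove m Y))
                          (*-cong refl (∏-differencesAbove m Y))))

  extend : ∀ {m} → (Fin m → Carrier) → ℕ → Carrier
  extend {zero}  X _       = 0#
  extend {suc m} X zero    = X Fin.zero
  extend {suc m} X (suc i) = extend (X ∘ Fin.suc) i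

  extend-toℕ : ∀ {m} (X : Fin m → Carrier) i → extend X (toℕ i) ≡ X i
  extend-toℕ X Fin.zero    = ≡.refl
  extend-toℕ X (Fin.suc i) = extend-toℕ (X ∘ Fin.suc) i

  ifBelow : ℕ → ℕ → Carrier → Carrier
  ifBelow i j v with i ℕ.<? j
  ... | yes _ = v
  ... | no  _ = 1#

  ifBelow-< : ∀ i j v → i ℕ.< j → ifBelow i j v ≡ v
  ifBelow-< i j v i<j with i ℕ.<? j
  ... | yes _   = ≡.refl
  ... | no  i≮j = ⊥-elim (i≮j i<j)

  ifBelow-≮ : ∀ i j v → ¬ i ℕ.< j → ifBelow i j v ≡ 1#
  ifBelow-≮ i j v i≮j with i ℕ.<? j
  ... | yes i<j = ⊥-elim (i≮j i<j)
  ... | no  _   = ≡.refl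

  ∏-ifBelow : ∀ m j f → j ℕ.≤ m → ∏ m (λ i → ifBelow i j (f i)) ≈ ∏ j f
  ∏-ifBelow m j f j≤m =
    ≡.subst (λ n → ∏ n (λ i → ifBelow i j (f i)) ≈ ∏ j f) (ℕ.m+[n∸m]≡n j≤m) (begin
      ∏ (j ℕ.+ (m ℕ.∸ j)) (λ i → ifBelow i j (f i))
    ≈⟨ ∏-split j (m ℕ.∸ j) _ ⟩
      ∏ j (λ i → ifBelow i j (f i)) * ∏ (m ℕ.∸ j) (λ l → ifBelow (j ℕ.+ l) j (f (j ℕ.+ l)))
    ≈⟨ *-cong (∏-cong j (λ i i<j → reflexive (ifBelow-< i j (f i) i<j)))
              (∏-one (m ℕ.∸ j) (λ l _ → reflexive (ifBelow-≮ (j ℕ.+ l) j _ (ℕ.≤⇒≯ (ℕ.m≤m+n j l))))) ⟩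
      ∏ j f * 1#
    ≈⟨ *-identityʳ _ ⟩
      ∏ j f
    ∎)

  mutual
    vanderProd4≈∏ : ∀ m (X : Fin m → Carrier) →
      vanderProd4 R m X ≈ ∏ m (λ j → ∏ m (λ i → ifBelow i j ((extend X j - extend X i) ^ 4)))
    vanderProd4≈∏ m X = product≈∏ m _ _ λ j → product≈∏ m _ _ λ i → vanderProd4-factor m X i j

    -- The factor of vanderProd4 is local to its definition, so the type of this case split
    -- can only be inferred from its use above.
    vanderProd4-factor : ∀ m (X : Fin m → Carrier) (i j : Fin m) → _
    vanderProd4-factor m X i j with i Fin.<? j
    ... | yes _ =
      reflexive (≡.cong₂ (λ x y → (x - y) ^ 4) (≡.sym (extend-toℕ X j)) (≡.sym (extend-toℕ X i)))
    ... | no  _ = refl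

  vanderProd4≈vandermonde^4 : ∀ m (X : Fin m → Carrier) → vanderProd4 R m X ≈ vandermonde m (extend X) ^ 4
  vanderProd4≈vandermonde^4 m X = begin
      vanderProd4 R m X
    ≈⟨ vanderProd4≈∏ m X ⟩
      ∏ m (λ j → ∏ m (λ i → ifBelow i j ((Y j - Y i) ^ 4)))
    ≈⟨ ∏-cong m (λ j j<m → ∏-ifBelow m j (λ i → (Y j - Y i) ^ 4) (ℕ.<⇒≤ j<m)) ⟩
      ∏ m (λ j → ∏ j (λ i → (Y j - Y i) ^ 4))
    ≈⟨ ∏-cong m (λ j _ → ∏-^ 4 j (λ i → Y j - Y i)) ⟩
      ∏ m (λ j → differencesBelow Y j ^ 4)
    ≈⟨ ∏-^ 4 m (differencesBelow Y) ⟩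
      vandermonde m Y ^ 4
    ∎
    where Y = extend X

  confluentMatrix≈confluentℕ : ∀ m (X : Fin m → Carrier) (r c : Fin (m ℕ.+ m)) →
    confluentMatrix R m X r c ≈ confluentℕ m (extend X) (toℕ r) (toℕ c)
  confluentMatrix≈confluentℕ m X r c with splitAt m r in split
  ... | inj₁ i = sym (begin
      confluentℕ m (extend X) (toℕ r) (toℕ c)
    ≡⟨ ≡.cong (λ k → confluentℕ m (extend X) k (toℕ c)) (toℕ-splitAt-inj₁ m split) ⟩
      confluentℕ m (extend X) (toℕ i) (toℕ c)
    ≡⟨ partialConfluent-< m (extend X) (extend X) _ (toℕ i) (toℕ c) (Fin.toℕ<n i) ⟩
      extend X (toℕ i) ^ toℕ c
    ≡⟨ ≡.cong (_^ toℕ c) (extend-toℕ X i) ⟩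
      X i ^ toℕ c
    ∎)
  ... | inj₂ i = sym (begin
      confluentℕ m (extend X) (toℕ r) (toℕ c)
    ≡⟨ ≡.cong (λ k → confluentℕ m (extend X) k (toℕ c)) (toℕ-splitAt-inj₂ m split) ⟩
      confluentℕ m (extend X) (m ℕ.+ toℕ i) (toℕ c)
    ≡⟨ partialConfluent-+ m (extend X) (extend X) _ (toℕ i) (toℕ c) ⟩
      mixedRow (extend X (toℕ i)) pureDerivative (toℕ c)
    ≡⟨ ≡.cong (λ x → mixedRow x pureDerivative (toℕ c)) (extend-toℕ X i) ⟩
      (suc (toℕ c) × X i ^ toℕ c) * 1# + X i ^ toℕ c * 0#
    ≈⟨ trans (+-cong (*-identityʳ _) (zeroʳ _)) (+-identityʳ _) ⟩
      suc (toℕ c) × X i ^ toℕ c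
    ∎)

  det-confluentMatrix : ∀ m (X : Fin m → Carrier) → det R (m ℕ.+ m) (confluentMatrix R m X) ≈ rhs R m X
  det-confluentMatrix m X = begin
      det R (m ℕ.+ m) (confluentMatrix R m X)
    ≈⟨ det≈detℕ (m ℕ.+ m) _ _ (confluentMatrix≈confluentℕ m X) ⟩
      detℕ (m ℕ.+ m) (confluentℕ m Y)
    ≈⟨ detℕ-confluentℕ m Y ⟩
      V * (∏ m (nodeWeight m Y) * V)
    ≈⟨ *-cong refl (*-cong (∏-nodeWeight m Y) refl) ⟩
      V * ((∏ m Y * (V * (σ * V))) * V)
    ≈⟨ solve 3 (λ V P σ → V :* ((P :* (V :* (σ :* V))) :* V)
                       := σ :* (P :* (V :* (V :* (V :* (V :* con 1))))))
             refl V (∏ m Y) σ ⟩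
      σ * (∏ m Y * V ^ 4)
    ≈⟨ *-cong (reflexive (≡.cong (negOnePow R) (triangle≡ m)))
              (*-cong (sym (product≈∏ m X Y (λ i → reflexive (≡.sym (extend-toℕ X i)))))
                      (sym (vanderProd4≈vandermonde^4 m X))) ⟩
      rhs R m X
    ∎
    where
    Y = extend X
    V = vandermonde m Y
    σ = (- 1#) ^ triangle m

open import Data.Nat using (_≥_; _+_)

-- The identity holds for m = 0 as well.
theorem1 : {c ℓ : Level} (R : CommutativeRing c ℓ) (m : ℕ) → m ≥ 1 → (X : Fin m → CommutativeRing.Carrier R) →
    CommutativeRing._≈_ R (det R (m + m) (confluentMatrix R m X)) (rhs R m X)
theorem1 R m _ X = ConfluentVandermonde.det-confluentMatrix R m X
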